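{- Let $q\ge 27$ be a prime power with $q\equiv 3\pmod 4$, let $\xi$ be a primitive element of $F_q$, and let $J$ be an integer with $(q-3)/4\le J\le (q-3)/2$. Let $\mathcal{D}_J=\{(1,\xi^d,\xi^{2d}): d=0,1,\dots,J\}$, $P=(0,1,0)$, $Z=(1,0,-1)$, $B_J=(1,0,-\xi^{2J})$. Then $\mathcal{E}_J=\mathcal{D}_J\cup\{P,Z,B_J\}$ is a $(J+4)$-arc in $PG(2,q)$.
   Context: Points of $PG(2,q)$ are in homogeneous coordinates $(x_0,x_1,x_2)$. An arc is a set of points no three collinear. -}

module Defs where

open import Level using (0ℓ)
open import Data.Nat as ℕ using (ℕ; zero; suc)
open import Data.Fin using (Fin)
open import Data.Product using (Σ; ∃; _×_; _,_)
open import Data.List using (List; length; lookup; map; upTo; _++_; _∷_; [])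
open import Relation.Nullary using (¬_)
open import Relation.Binary.PropositionalEquality using (_≡_; _≢_)
open import Algebra.Structures using (IsCommutativeRing)
open import Function.Bundles using (_↔_)

record FiniteField (q : ℕ) : Set₁ where
  infixl 6 _+_
  infixl 7 _*_
  field
    Carrier : Set
    _+_ _*_ : Carrier → Carrier → Carrier
    -_      : Carrier → Carrier
    0# 1#   : Carrier
    isCommutativeRing : IsCommutativeRing _≡_ _+_ _*_ -_ 0# 1#
    0≢1     : 0# ≢ 1#
    inverse : ∀ x → x ≢ 0# → ∃ λ y → x * y ≡ 1#
    enum    : Fin q ↔ Carrier

  _^_ : Carrier → ℕ → Carrier
  x ^ zero  = 1#
  x ^ suc n = x * (x ^ n)

  IsPrimitive : Carrier → Set
  IsPrimitive ξ = ξ ≢ 0# × (∀ x → x ≢ 0# → ∃ λ k → ξ ^ k ≡ x)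

  record Triple : Set where
    constructor ⟨_,_,_⟩
    field
      c0 c1 c2 : Carrier
  open Triple public

  -- a triple represents a point of PG(2,q) iff it is nonzero
  NonZeroTriple : Triple → Set
  NonZeroTriple u = ¬ (c0 u ≡ 0# × c1 u ≡ 0# × c2 u ≡ 0#)

  SamePoint : Triple → Triple → Set
  SamePoint u v = ∃ λ λ' → λ' ≢ 0# × (c0 v ≡ λ' * c0 u × c1 v ≡ λ' * c1 u × c2 v ≡ λ' * c2 u)

  OnLine : Triple → Triple → Set
  OnLine a u = c0 a * c0 u + c1 a * c1 u + c2 a * c2 u ≡ 0#

  Collinear : Triple → Triple → Triple → Set
  Collinear u v w = ∃ λ a → NonZeroTriple a × OnLine a u × OnLine a v × OnLine a w

  IsArc : ℕ → List Triple → Set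
  IsArc k pts =
    length pts ≡ k ×
    (∀ i → NonZeroTriple (lookup pts i)) ×
    (∀ i j → i ≢ j → ¬ SamePoint (lookup pts i) (lookup pts j)) ×
    (∀ i j l → i ≢ j → j ≢ l → i ≢ l →
       ¬ Collinear (lookup pts i) (lookup pts j) (lookup pts l))

  D : Carrier → ℕ → List Triple
  D ξ J = map (λ d → ⟨ 1# , ξ ^ d , ξ ^ (2 ℕ.* d) ⟩) (upTo (suc J))

  P Z : Triple
  P = ⟨ 0# , 1# , 0# ⟩
  Z = ⟨ 1# , 0# , - 1# ⟩

  B : Carrier → ℕ → Triple
  B ξ J = ⟨ 1# , 0# , - (ξ ^ (2 ℕ.* J)) ⟩

  E : Carrier → ℕ → List Triple
  E ξ J = D ξ J ++ (P ∷ Z ∷ B ξ J ∷ [])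

open import Data.Nat.Primality using (Prime)
IsPrimePower : ℕ → Set
IsPrimePower q = ∃ λ p → ∃ λ n → Prime p × 1 ℕ.≤ n × q ≡ p ℕ.^ n

module Submission where

-- Write q = 4m + 3, so ξ has order N = q - 1 = 2h with h = 2m + 1 odd, and the
-- hypotheses give 1 ≤ J ≤ 2m.  Three points of PG(2,q) are non-collinear as soon
-- as their 3×3 determinant is nonzero (Cramer's rule), and a list in which any
-- three distinct entries have nonzero determinant is an arc.  The entries of E_J
-- are points (1, t, t²) of a conic with t = ξ^d, d ≤ J, the point P = (0,1,0) and
-- two points (1, 0, -y²) with y = 1, ξ^J.  Each determinant of three of them
-- factors into differences t - s, sums s + t, terms y² - st, sums of squares
-- t² + y² and y², and each factor is nonzero: exponent sums stay below N, where
-- powers of ξ are injective, and -1 is a non-square in F_q because h is odd.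

open import Defs
open import Level using (0ℓ)
open import Data.Nat as ℕ using (ℕ; zero; suc; z≤n; s≤s; _%_; _/_; _∸_)
import Data.Nat.Properties as ℕP
open import Data.Nat.DivMod using (m≡m%n+[m/n]*n; m%n<n; [m+kn]%n≡m%n; m∣n⇒o%n%m≡o%m; m*n%n≡0; m*n/n≡m)
open import Data.Nat.Divisibility using (_∣_; divides)
open import Data.Nat.Tactic.RingSolver using (solve-∀)
open import Data.Integer as ℤ using (ℤ; -[1+_]; sign; ∣_∣; _◃_; _⊖_)
import Data.Integer.Properties as ℤP
open import Data.Sign as Sign using (Sign)
open import Data.Fin as Fin using (Fin; toℕ)
import Data.Fin.Properties as FinP
open import Data.List using (List; length; lookup; map; upTo; _++_; _∷_; [])
import Data.List.Properties as LP
open import Data.Maybe using (Maybe; just; nothing)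
open import Data.Product using (∃; _×_; _,_; proj₁; proj₂)
open import Data.Sum using (_⊎_; inj₁; inj₂)
open import Data.Unit using (⊤; tt)
open import Data.Empty using (⊥-elim)
open import Relation.Nullary using (¬_; Dec; yes; no; map′)
open import Relation.Binary.Definitions using (tri<; tri≈; tri>)
open import Relation.Binary.PropositionalEquality
open import Function.Bundles using (Inverse)
open import Algebra.Bundles using (CommutativeRing)
open import Algebra.Structures using (IsCommutativeRing)
import Algebra.Properties.Ring as RingProperties
open import Algebra.Solver.Ring.AlmostCommutativeRing using (_-Raw-AlmostCommutative⟶_; fromCommutativeRing)

-- Any commutative ring whose equality is propositional equality admits the
-- integers as coefficients for the (non-reflective) ring solver of the
-- library: n ↦ n ⨯ 1#, -[1+ n ] ↦ - ((1 + n) ⨯ 1#) is a ring morphism ℤ → R,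
-- chosen so that the constants + 0 and + 1 denote 0# and 1# definitionally.
module IntegerCoefficients {A : Set} {add mul : A → A → A} {neg : A → A} {zeroᴬ oneᴬ : A}
  (isCommutativeRing : IsCommutativeRing _≡_ add mul neg zeroᴬ oneᴬ) where

  commutativeRing : CommutativeRing 0ℓ 0ℓ
  commutativeRing = record { isCommutativeRing = isCommutativeRing }

  open CommutativeRing commutativeRing
    using (Carrier; _+_; _*_; -_; 0#; 1#; ring; semiring; *-commutativeSemigroup;
           +-assoc; +-comm; +-identityˡ; +-identityʳ; -‿inverseʳ; zeroʳ; *-identityˡ)
  open RingProperties ring using (-1*x≈-x; -‿involutive; -0#≈0#; -‿+-comm)
  open import Algebra.Properties.Semiring.Mult.TCOptimised semiring
    using (1+×; ×-homo-+; ×1-homo-*) renaming (_×_ to _⨯_)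
  open import Algebra.Properties.CommutativeSemigroup *-commutativeSemigroup using (interchange)
  open ≡-Reasoning

  ⟦_⟧ℤ : ℤ → Carrier
  ⟦ ℤ.+ n ⟧ℤ    = n ⨯ 1#
  ⟦ -[1+ n ] ⟧ℤ = - (suc n ⨯ 1#)

  sign⟦_⟧ : Sign → Carrier
  sign⟦ Sign.+ ⟧ = 1#
  sign⟦ Sign.- ⟧ = - 1#

  sign-homo : ∀ s t → sign⟦ s Sign.* t ⟧ ≡ sign⟦ s ⟧ * sign⟦ t ⟧
  sign-homo Sign.+ t      = sym (*-identityˡ _)
  sign-homo Sign.- Sign.+ = sym (-1*x≈-x 1#)
  sign-homo Sign.- Sign.- = begin
    1#              ≡⟨ sym (-‿involutive 1#) ⟩
    - (- 1#)        ≡⟨ sym (-1*x≈-x (- 1#)) ⟩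
    - 1# * - 1#     ∎

  ◃-homo : ∀ s n → ⟦ s ◃ n ⟧ℤ ≡ sign⟦ s ⟧ * (n ⨯ 1#)
  ◃-homo s      zero    = sym (zeroʳ _)
  ◃-homo Sign.+ (suc n) = sym (*-identityˡ _)
  ◃-homo Sign.- (suc n) = sym (-1*x≈-x _)

  *-homo : ∀ i j → ⟦ i ℤ.* j ⟧ℤ ≡ ⟦ i ⟧ℤ * ⟦ j ⟧ℤ
  *-homo i j = begin
    ⟦ sign i Sign.* sign j ◃ ∣ i ∣ ℕ.* ∣ j ∣ ⟧ℤ                ≡⟨ ◃-homo (sign i Sign.* sign j) (∣ i ∣ ℕ.* ∣ j ∣) ⟩
    sign⟦ sign i Sign.* sign j ⟧ * ((∣ i ∣ ℕ.* ∣ j ∣) ⨯ 1#)     ≡⟨ cong₂ _*_ (sign-homo (sign i) (sign j)) (×1-homo-* ∣ i ∣ ∣ j ∣) ⟩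
    (sign⟦ sign i ⟧ * sign⟦ sign j ⟧) * ((∣ i ∣ ⨯ 1#) * (∣ j ∣ ⨯ 1#)) ≡⟨ interchange _ _ _ _ ⟩
    (sign⟦ sign i ⟧ * (∣ i ∣ ⨯ 1#)) * (sign⟦ sign j ⟧ * (∣ j ∣ ⨯ 1#)) ≡⟨ sym (cong₂ _*_ (◃-homo (sign i) ∣ i ∣) (◃-homo (sign j) ∣ j ∣)) ⟩
    ⟦ sign i ◃ ∣ i ∣ ⟧ℤ * ⟦ sign j ◃ ∣ j ∣ ⟧ℤ                   ≡⟨ cong₂ (λ a b → ⟦ a ⟧ℤ * ⟦ b ⟧ℤ) (ℤP.◃-inverse i) (ℤP.◃-inverse j) ⟩
    ⟦ i ⟧ℤ * ⟦ j ⟧ℤ                                             ∎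

  neg-homo : ∀ i → ⟦ ℤ.- i ⟧ℤ ≡ - ⟦ i ⟧ℤ
  neg-homo (ℤ.+ zero)  = sym -0#≈0#
  neg-homo (ℤ.+ suc n) = refl
  neg-homo -[1+ n ]    = sym (-‿involutive _)

  shift-difference : ∀ a b → (1# + a) + - (1# + b) ≡ a + - b
  shift-difference a b = begin
    (1# + a) + - (1# + b)        ≡⟨ cong₂ _+_ (+-comm 1# a) (sym (-‿+-comm 1# b)) ⟩
    (a + 1#) + (- 1# + - b)      ≡⟨ +-assoc a 1# _ ⟩
    a + (1# + (- 1# + - b))      ≡⟨ cong (a +_) (sym (+-assoc 1# (- 1#) (- b))) ⟩
    a + ((1# + - 1#) + - b)      ≡⟨ cong (λ z → a + (z + - b)) (-‿inverseʳ 1#) ⟩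
    a + (0# + - b)               ≡⟨ cong (a +_) (+-identityˡ (- b)) ⟩
    a + - b                      ∎

  ⊖-homo : ∀ m n → ⟦ m ⊖ n ⟧ℤ ≡ (m ⨯ 1#) + - (n ⨯ 1#)
  ⊖-homo zero    zero    = sym (-‿inverseʳ 0#)
  ⊖-homo (suc m) zero    = sym (trans (cong (suc m ⨯ 1# +_) -0#≈0#) (+-identityʳ _))
  ⊖-homo zero    (suc n) = sym (+-identityˡ _)
  ⊖-homo (suc m) (suc n) = begin
    ⟦ suc m ⊖ suc n ⟧ℤ                       ≡⟨ cong ⟦_⟧ℤ (ℤP.[1+m]⊖[1+n]≡m⊖n m n) ⟩
    ⟦ m ⊖ n ⟧ℤ                               ≡⟨ ⊖-homo m n ⟩
    (m ⨯ 1#) + - (n ⨯ 1#)                    ≡⟨ sym (shift-difference (m ⨯ 1#) (n ⨯ 1#)) ⟩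
    (1# + m ⨯ 1#) + - (1# + n ⨯ 1#)          ≡⟨ sym (cong₂ (λ a b → a + - b) (1+× m 1#) (1+× n 1#)) ⟩
    (suc m ⨯ 1#) + - (suc n ⨯ 1#)            ∎

  +-homo : ∀ i j → ⟦ i ℤ.+ j ⟧ℤ ≡ ⟦ i ⟧ℤ + ⟦ j ⟧ℤ
  +-homo (ℤ.+ m)  (ℤ.+ n)  = ×-homo-+ 1# m n
  +-homo (ℤ.+ m)  -[1+ n ] = ⊖-homo m (suc n)
  +-homo -[1+ m ] (ℤ.+ n)  = trans (⊖-homo n (suc m)) (+-comm _ _)
  +-homo -[1+ m ] -[1+ n ] = begin
    - (suc (suc (m ℕ.+ n)) ⨯ 1#)             ≡⟨ cong (λ k → - (k ⨯ 1#)) (sym (ℕP.+-suc (suc m) n)) ⟩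
    - ((suc m ℕ.+ suc n) ⨯ 1#)               ≡⟨ cong -_ (×-homo-+ 1# (suc m) (suc n)) ⟩
    - (suc m ⨯ 1# + suc n ⨯ 1#)              ≡⟨ sym (-‿+-comm _ _) ⟩
    - (suc m ⨯ 1#) + - (suc n ⨯ 1#)          ∎

  morphism : ℤ.+-*-rawRing -Raw-AlmostCommutative⟶ fromCommutativeRing commutativeRing
  morphism = record
    { ⟦_⟧ = ⟦_⟧ℤ ; +-homo = +-homo ; *-homo = *-homo ; -‿homo = neg-homo
    ; 0-homo = refl ; 1-homo = refl }

  equal? : ∀ i j → Maybe (⟦ i ⟧ℤ ≡ ⟦ j ⟧ℤ)
  equal? i j with i ℤ.≟ j
  ... | yes refl = just refl
  ... | no _     = nothing

  open import Algebra.Solver.Ring ℤ.+-*-rawRing (fromCommutativeRing commutativeRing) morphism equal? public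
    using (solve; _:=_; _:+_; _:*_; _:-_; :-_; con; Polynomial)

  :0 :1 : ∀ {n} → Polynomial n
  :0 = con (ℤ.+ 0)
  :1 = con (ℤ.+ 1)


module FieldFacts {q : ℕ} (F : FiniteField q) where
  open FiniteField F public
  open IsCommutativeRing isCommutativeRing public
    using (*-assoc; *-comm; +-identityˡ; +-identityʳ; *-identityˡ; *-identityʳ;
           zeroˡ; zeroʳ; -‿inverseʳ)
  open IntegerCoefficients isCommutativeRing public using (solve; _:=_; _:+_; _:*_; _:-_; :-_; :0; :1; Polynomial)
  open RingProperties (CommutativeRing.ring (IntegerCoefficients.commutativeRing isCommutativeRing))
    public using (-0#≈0#; -‿involutive; -1*x≈-x; x∙y⁻¹≈ε⇒x≈y; +-inverseˡ-unique)

  -- subtraction; unfolds to the solver's  _:-_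
  infixl 6 _-_
  _-_ : Carrier → Carrier → Carrier
  x - y = x + - y

  infixr 1 _▹_
  _▹_ : ∀ {x y} → x ≡ y → y ≢ 0# → x ≢ 0#
  (x≡y ▹ y≢0) x≡0 = y≢0 (trans (sym x≡y) x≡0)

  nonzero-factor : ∀ {x y} → x ≢ 0# → x * y ≡ 0# → y ≡ 0#
  nonzero-factor {x} {y} x≢0 xy≡0 with inverse x x≢0
  ... | x⁻¹ , xx⁻¹≡1 = begin
    y              ≡⟨ sym (*-identityˡ y) ⟩
    1# * y         ≡⟨ cong (_* y) (trans (sym xx⁻¹≡1) (*-comm x x⁻¹)) ⟩
    (x⁻¹ * x) * y  ≡⟨ *-assoc x⁻¹ x y ⟩
    x⁻¹ * (x * y)  ≡⟨ cong (x⁻¹ *_) xy≡0 ⟩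
    x⁻¹ * 0#       ≡⟨ zeroʳ x⁻¹ ⟩
    0#             ∎
    where open ≡-Reasoning

  *-nonzero : ∀ {x y} → x ≢ 0# → y ≢ 0# → x * y ≢ 0#
  *-nonzero x≢0 y≢0 xy≡0 = y≢0 (nonzero-factor x≢0 xy≡0)

  -‿nonzero : ∀ {x} → x ≢ 0# → - x ≢ 0#
  -‿nonzero {x} x≢0 -x≡0 = x≢0 (trans (sym (-‿involutive x)) (trans (cong -_ -x≡0) -0#≈0#))

  difference-nonzero : ∀ {x y} → x ≢ y → x - y ≢ 0#
  difference-nonzero x≢y x-y≡0 = x≢y (x∙y⁻¹≈ε⇒x≈y _ _ x-y≡0)

  *-cancelˡ : ∀ {x y z} → x ≢ 0# → x * y ≡ x * z → y ≡ z
  *-cancelˡ {x} {y} {z} x≢0 xy≡xz = x∙y⁻¹≈ε⇒x≈y y z (nonzero-factor x≢0 (begin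
    x * (y - z)       ≡⟨ distrib x y z ⟩
    x * y - x * z     ≡⟨ cong (_- x * z) xy≡xz ⟩
    x * z - x * z     ≡⟨ -‿inverseʳ (x * z) ⟩
    0#                ∎))
    where
    open ≡-Reasoning
    distrib : ∀ x y z → x * (y - z) ≡ x * y - x * z
    distrib = solve 3 (λ x y z → x :* (y :- z) := x :* y :- x :* z) refl

  square-root-of-one : ∀ {x} → x * x ≡ 1# → x ≢ 1# → x ≡ - 1#
  square-root-of-one {x} xx≡1 x≢1 = +-inverseˡ-unique x 1# (nonzero-factor (difference-nonzero x≢1) (begin
    (x - 1#) * (x + 1#) ≡⟨ difference-of-squares x ⟩
    x * x - 1#          ≡⟨ cong (_- 1#) xx≡1 ⟩
    1# - 1#             ≡⟨ -‿inverseʳ 1# ⟩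
    0#                  ∎))
    where
    open ≡-Reasoning
    difference-of-squares : ∀ x → (x - 1#) * (x + 1#) ≡ x * x - 1#
    difference-of-squares = solve 1 (λ x → (x :- :1) :* (x :+ :1) := x :* x :- :1) refl

  ^-+ : ∀ x m n → x ^ (m ℕ.+ n) ≡ x ^ m * x ^ n
  ^-+ x zero    n = sym (*-identityˡ _)
  ^-+ x (suc m) n = trans (cong (x *_) (^-+ x m n)) (sym (*-assoc x _ _))

  ^-nonzero : ∀ {x} n → x ≢ 0# → x ^ n ≢ 0#
  ^-nonzero zero    x≢0 1≡0 = 0≢1 (sym 1≡0)
  ^-nonzero (suc n) x≢0     = *-nonzero x≢0 (^-nonzero n x≢0)

  ^-period : ∀ {x} m k → x ≢ 0# → x ^ m ≡ x ^ (m ℕ.+ k) → x ^ k ≡ 1#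
  ^-period {x} m k x≢0 xᵐ≡xᵐ⁺ᵏ = sym (*-cancelˡ (^-nonzero m x≢0)
    (trans (*-identityʳ _) (trans xᵐ≡xᵐ⁺ᵏ (^-+ x m k))))

  ^-mod : ∀ {x} N .{{_ : ℕ.NonZero N}} → x ^ N ≡ 1# → ∀ n → x ^ n ≡ x ^ (n % N)
  ^-mod {x} N xᴺ≡1 n = begin
    x ^ n                              ≡⟨ cong (x ^_) (m≡m%n+[m/n]*n n N) ⟩
    x ^ (n % N ℕ.+ (n / N) ℕ.* N)      ≡⟨ ^-+ x (n % N) _ ⟩
    x ^ (n % N) * x ^ ((n / N) ℕ.* N)  ≡⟨ cong (x ^ (n % N) *_) (multiple (n / N)) ⟩
    x ^ (n % N) * 1#                   ≡⟨ *-identityʳ _ ⟩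
    x ^ (n % N)                        ∎
    where
    open ≡-Reasoning
    multiple : ∀ j → x ^ (j ℕ.* N) ≡ 1#
    multiple zero    = refl
    multiple (suc j) = trans (^-+ x N (j ℕ.* N)) (trans (cong₂ _*_ xᴺ≡1 (multiple j)) (*-identityˡ 1#))

  open Inverse enum using (to; from; strictlyInverseˡ; strictlyInverseʳ)

  from-injective : ∀ {x y} → from x ≡ from y → x ≡ y
  from-injective {x} {y} eq = trans (sym (strictlyInverseˡ x)) (trans (cong to eq) (strictlyInverseˡ y))

  _≟_ : (x y : Carrier) → Dec (x ≡ y)
  x ≟ y = map′ from-injective (cong from) (from x Fin.≟ from y)

  surjection-bound : ∀ {k} (f : Fin k → Carrier) → (∀ x → ∃ λ i → f i ≡ x) → q ℕ.≤ k
  surjection-bound f onto = FinP.injective⇒≤ {f = λ j → proj₁ (onto (to j))} injective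
    where
    injective : ∀ {j j′} → proj₁ (onto (to j)) ≡ proj₁ (onto (to j′)) → j ≡ j′
    injective {j} {j′} eq = trans (sym (strictlyInverseʳ j)) (trans (cong from
      (trans (sym (proj₂ (onto (to j)))) (trans (cong f eq) (proj₂ (onto (to j′)))))) (strictlyInverseʳ j′))

-- ℕ-level parity fact behind "-1 is not a square when q ≡ 3 (mod 4)":
-- modulo an even N = 2h with h odd, an even number is never congruent to h + even.
even-vs-odd-mod : ∀ N h a b .{{_ : ℕ.NonZero N}} → N ≡ h ℕ.+ h → h % 2 ≡ 1 →
                  (a ℕ.+ a) % N ≢ (h ℕ.+ (b ℕ.+ b)) % N
even-vs-odd-mod N h a b N≡h+h h-odd same = 0≢1 (begin
  0                          ≡⟨ sym (m*n%n≡0 a 2) ⟩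
  (a ℕ.* 2) % 2              ≡⟨ cong (_% 2) (double a) ⟩
  (a ℕ.+ a) % 2              ≡⟨ sym (m∣n⇒o%n%m≡o%m 2 N (a ℕ.+ a) 2∣N) ⟩
  (a ℕ.+ a) % N % 2          ≡⟨ cong (_% 2) same ⟩
  (h ℕ.+ (b ℕ.+ b)) % N % 2  ≡⟨ m∣n⇒o%n%m≡o%m 2 N (h ℕ.+ (b ℕ.+ b)) 2∣N ⟩
  (h ℕ.+ (b ℕ.+ b)) % 2      ≡⟨ cong (λ e → (h ℕ.+ e) % 2) (sym (double b)) ⟩
  (h ℕ.+ b ℕ.* 2) % 2        ≡⟨ [m+kn]%n≡m%n h b 2 ⟩
  h % 2                      ≡⟨ h-odd ⟩
  1                          ∎)
  where
  open ≡-Reasoning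
  double : ∀ n → n ℕ.* 2 ≡ n ℕ.+ n
  double = solve-∀
  2∣N : 2 ∣ N
  2∣N = divides h (trans N≡h+h (sym (double h)))
  0≢1 : 0 ≢ 1
  0≢1 ()

module PrimitiveElement {q : ℕ} (F : FiniteField q) (ξ : FiniteField.Carrier F)
  (ξ-primitive : FiniteField.IsPrimitive F ξ) (N : ℕ) .{{_ : ℕ.NonZero N}} (q≡1+N : q ≡ suc N) where
  open FieldFacts F

  ξ≢0 : ξ ≢ 0#
  ξ≢0 = proj₁ ξ-primitive

  -- if ξ^(1+k) = 1 then 0, ξ^0, …, ξ^k exhaust the field, so 1 + k ≥ N
  period-bound : ∀ k → ξ ^ suc k ≡ 1# → N ℕ.≤ suc k
  period-bound k period = ℕP.≤-pred (subst (ℕ._≤ suc (suc k)) q≡1+N (surjection-bound cover onto))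
    where
    cover : Fin (suc (suc k)) → Carrier
    cover Fin.zero    = 0#
    cover (Fin.suc i) = ξ ^ toℕ i
    onto : ∀ x → ∃ λ i → cover i ≡ x
    onto x with x ≟ 0#
    ... | yes x≡0 = Fin.zero , sym x≡0
    ... | no x≢0 with proj₂ ξ-primitive x x≢0
    ...   | n , ξⁿ≡x = Fin.suc (Fin.fromℕ< (m%n<n n (suc k))) , (begin
      ξ ^ toℕ (Fin.fromℕ< (m%n<n n (suc k))) ≡⟨ cong (ξ ^_) (FinP.toℕ-fromℕ< (m%n<n n (suc k))) ⟩
      ξ ^ (n % suc k)                         ≡⟨ sym (^-mod (suc k) period n) ⟩
      ξ ^ n                                   ≡⟨ ξⁿ≡x ⟩
      x                                       ∎)
      where open ≡-Reasoning

  -- powers with exponents below N are pairwise distinct: ξ^a = ξ^b with a < b < N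
  -- would give a period b - a < N
  ^-injective-< : ∀ {a b} → a ℕ.< b → b ℕ.< N → ξ ^ a ≢ ξ ^ b
  ^-injective-< {a} {b} a<b b<N ξᵃ≡ξᵇ with ℕP.m≤n⇒∃[o]m+o≡n a<b
  ... | k , 1+a+k≡b = ℕP.<⇒≱ (ℕP.≤-<-trans (ℕP.m≤n+m (suc k) a) (subst (ℕ._< N) b≡a+1+k b<N))
                               (period-bound k (^-period a (suc k) ξ≢0 (subst (λ e → ξ ^ a ≡ ξ ^ e) b≡a+1+k ξᵃ≡ξᵇ)))
    where
    b≡a+1+k : b ≡ a ℕ.+ suc k
    b≡a+1+k = trans (sym 1+a+k≡b) (sym (ℕP.+-suc a k))

  ^-injective : ∀ {a b} → a ℕ.< N → b ℕ.< N → ξ ^ a ≡ ξ ^ b → a ≡ b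
  ^-injective {a} {b} a<N b<N ξᵃ≡ξᵇ with ℕP.<-cmp a b
  ... | tri< a<b _ _ = ⊥-elim (^-injective-< a<b b<N ξᵃ≡ξᵇ)
  ... | tri≈ _ a≡b _ = a≡b
  ... | tri> _ _ b<a = ⊥-elim (^-injective-< b<a a<N (sym ξᵃ≡ξᵇ))

  -- Fermat: among 0, ξ^0, …, ξ^N two values coincide; the resulting period is N
  ξ^N≡1 : ξ ^ N ≡ 1#
  ξ^N≡1 with FinP.pigeonhole (ℕP.n<1+n q) (λ i → Inverse.from enum (values i))
    where
    values : Fin (suc q) → Carrier
    values Fin.zero    = 0#
    values (Fin.suc i) = ξ ^ toℕ i
  ... | Fin.zero  , Fin.suc j , _      , eq = ⊥-elim (^-nonzero (toℕ j) ξ≢0 (sym (from-injective eq)))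
  ... | Fin.suc i , Fin.suc j , s≤s i<j , eq with ℕP.m≤n⇒∃[o]m+o≡n i<j
  ...   | k , 1+i+k≡j = subst (λ e → ξ ^ e ≡ 1#) (ℕP.≤-antisym (ℕP.≤-trans k<j j≤N) (period-bound k period)) period
    where
    j≡i+1+k : toℕ j ≡ toℕ i ℕ.+ suc k
    j≡i+1+k = trans (sym 1+i+k≡j) (sym (ℕP.+-suc (toℕ i) k))
    period : ξ ^ suc k ≡ 1#
    period = ^-period (toℕ i) (suc k) ξ≢0 (subst (λ e → ξ ^ toℕ i ≡ ξ ^ e) j≡i+1+k (from-injective eq))
    k<j : suc k ℕ.≤ toℕ j
    k<j = subst (suc k ℕ.≤_) (sym j≡i+1+k) (ℕP.m≤n+m (suc k) (toℕ i))
    j≤N : toℕ j ℕ.≤ N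
    j≤N = ℕP.≤-pred (subst (toℕ j ℕ.<_) q≡1+N (FinP.toℕ<n j))

  ^-≡⇒%-≡ : ∀ {a b} → ξ ^ a ≡ ξ ^ b → a % N ≡ b % N
  ^-≡⇒%-≡ {a} {b} ξᵃ≡ξᵇ = ^-injective (m%n<n a N) (m%n<n b N)
    (trans (sym (^-mod N ξ^N≡1 a)) (trans ξᵃ≡ξᵇ (^-mod N ξ^N≡1 b)))

  -- for N = 2h, ξ^h is a square root of 1 other than 1
  ξ^half≡-1 : ∀ h → N ≡ h ℕ.+ h → ξ ^ h ≡ - 1#
  ξ^half≡-1 h N≡h+h = square-root-of-one
    (trans (sym (^-+ ξ h h)) (trans (cong (ξ ^_) (sym N≡h+h)) ξ^N≡1))
    (λ ξʰ≡1 → ^-injective-< 0<h h<N (sym ξʰ≡1))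
    where
    0<h : 0 ℕ.< h
    0<h = ℕP.n≢0⇒n>0 (λ h≡0 → ℕ.≢-nonZero⁻¹ N (trans N≡h+h (cong₂ ℕ._+_ h≡0 h≡0)))
    h<N : h ℕ.< N
    h<N = subst (h ℕ.<_) (sym N≡h+h) (ℕP.m<m+n h 0<h)

  sum-of-squares-nonzero : ∀ h → N ≡ h ℕ.+ h → h % 2 ≡ 1 → ∀ x y → y ≢ 0# → x * x + y * y ≢ 0#
  sum-of-squares-nonzero h N≡h+h h-odd x y y≢0 sum≡0 with x ≟ 0#
  ... | yes refl = *-nonzero y≢0 y≢0 (trans (sym (trans (cong (_+ y * y) (zeroˡ 0#)) (+-identityˡ (y * y)))) sum≡0)
  ... | no x≢0 with proj₂ ξ-primitive x x≢0 | proj₂ ξ-primitive y y≢0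
  ...   | a , refl | b , refl = even-vs-odd-mod N h a b N≡h+h h-odd (^-≡⇒%-≡ (begin
    ξ ^ (a ℕ.+ a)               ≡⟨ ^-+ ξ a a ⟩
    ξ ^ a * ξ ^ a               ≡⟨ +-inverseˡ-unique _ _ sum≡0 ⟩
    - (ξ ^ b * ξ ^ b)           ≡⟨ sym (-1*x≈-x _) ⟩
    - 1# * (ξ ^ b * ξ ^ b)      ≡⟨ cong₂ _*_ (sym (ξ^half≡-1 h N≡h+h)) (sym (^-+ ξ b b)) ⟩
    ξ ^ h * ξ ^ (b ℕ.+ b)       ≡⟨ sym (^-+ ξ h (b ℕ.+ b)) ⟩
    ξ ^ (h ℕ.+ (b ℕ.+ b))       ∎))
    where open ≡-Reasoning

avoid : ∀ {n} → 3 ℕ.≤ n → (i j : Fin n) → ∃ λ l → i ≢ l × j ≢ l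
avoid (s≤s (s≤s (s≤s _))) Fin.zero             Fin.zero             = Fin.suc Fin.zero , (λ ()) , (λ ())
avoid (s≤s (s≤s (s≤s _))) Fin.zero             (Fin.suc Fin.zero)   = Fin.suc (Fin.suc Fin.zero) , (λ ()) , (λ ())
avoid (s≤s (s≤s (s≤s _))) Fin.zero             (Fin.suc (Fin.suc _)) = Fin.suc Fin.zero , (λ ()) , (λ ())
avoid (s≤s (s≤s (s≤s _))) (Fin.suc Fin.zero)   Fin.zero             = Fin.suc (Fin.suc Fin.zero) , (λ ()) , (λ ())
avoid (s≤s (s≤s (s≤s _))) (Fin.suc (Fin.suc _)) Fin.zero           = Fin.suc Fin.zero , (λ ()) , (λ ())
avoid (s≤s (s≤s (s≤s _))) (Fin.suc _)          (Fin.suc _)          = Fin.zero , (λ ()) , (λ ())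

-- Determinant, minors and bilinear pairing of coordinate triples, written over an
-- arbitrary signature so that they serve both for field elements and for
-- ring-solver expressions.
module Determinant {A : Set} (_⊕_ _⊗_ : A → A → A) (neg : A → A) where
  minor : (x₁ x₂ y₁ y₂ : A) → A
  minor x₁ x₂ y₁ y₂ = (x₁ ⊗ y₂) ⊕ neg (x₂ ⊗ y₁)

  det₃ : (u₀ u₁ u₂ v₀ v₁ v₂ w₀ w₁ w₂ : A) → A
  det₃ u₀ u₁ u₂ v₀ v₁ v₂ w₀ w₁ w₂ =
    ((u₀ ⊗ minor v₁ v₂ w₁ w₂) ⊕ neg (u₁ ⊗ minor v₀ v₂ w₀ w₂)) ⊕ (u₂ ⊗ minor v₀ v₁ w₀ w₁)

  dot₃ : (a₀ a₁ a₂ x₀ x₁ x₂ : A) → A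
  dot₃ a₀ a₁ a₂ x₀ x₁ x₂ = ((a₀ ⊗ x₀) ⊕ (a₁ ⊗ x₁)) ⊕ (a₂ ⊗ x₂)

module ProjectivePlane {q : ℕ} (F : FiniteField q) where
  open FieldFacts F
  open Determinant _+_ _*_ -_ using (minor; det₃; dot₃)
  open module Syntax {n} = Determinant {Polynomial n} _:+_ _:*_ :-_
    public renaming (minor to :minor; det₃ to :det₃; dot₃ to :dot₃)

  det : Triple → Triple → Triple → Carrier
  det u v w = det₃ (c0 u) (c1 u) (c2 u) (c0 v) (c1 v) (c2 v) (c0 w) (c1 w) (c2 w)

  -- Cramer's rule: det(u,v,w)·aₖ is a combination of the values of the line a
  -- at u, v and w, so a line through all three points forces det = 0.
  det-nonzero⇒¬collinear : ∀ u v w → det u v w ≢ 0# → ¬ Collinear u v w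
  det-nonzero⇒¬collinear ⟨ u₀ , u₁ , u₂ ⟩ ⟨ v₀ , v₁ , v₂ ⟩ ⟨ w₀ , w₁ , w₂ ⟩ det≢0
    (⟨ a₀ , a₁ , a₂ ⟩ , a≢0 , a∋u , a∋v , a∋w) = a≢0 (vanishes cramer₀ , vanishes cramer₁ , vanishes cramer₂)
    where
    d a·u a·v a·w : Carrier
    d = det ⟨ u₀ , u₁ , u₂ ⟩ ⟨ v₀ , v₁ , v₂ ⟩ ⟨ w₀ , w₁ , w₂ ⟩
    a·u = dot₃ a₀ a₁ a₂ u₀ u₁ u₂
    a·v = dot₃ a₀ a₁ a₂ v₀ v₁ v₂
    a·w = dot₃ a₀ a₁ a₂ w₀ w₁ w₂

    vanishes : ∀ {aₖ X Y Z} → d * aₖ ≡ X * a·u + Y * a·v + Z * a·w → aₖ ≡ 0#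
    vanishes {aₖ} {X} {Y} {Z} cramer = nonzero-factor det≢0 (begin
      d * aₖ                    ≡⟨ cramer ⟩
      X * a·u + Y * a·v + Z * a·w ≡⟨ cong₂ _+_ (cong₂ _+_ (cong (X *_) a∋u) (cong (Y *_) a∋v)) (cong (Z *_) a∋w) ⟩
      X * 0# + Y * 0# + Z * 0#  ≡⟨ cong₂ _+_ (cong₂ _+_ (zeroʳ X) (zeroʳ Y)) (zeroʳ Z) ⟩
      0# + 0# + 0#              ≡⟨ trans (+-identityʳ _) (+-identityʳ 0#) ⟩
      0#                        ∎)
      where open ≡-Reasoning

    cramer₀ : d * a₀ ≡ minor v₁ v₂ w₁ w₂ * a·u + minor w₁ w₂ u₁ u₂ * a·v + minor u₁ u₂ v₁ v₂ * a·w
    cramer₀ = solve 12 (λ u₀ u₁ u₂ v₀ v₁ v₂ w₀ w₁ w₂ a₀ a₁ a₂ →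
      :det₃ u₀ u₁ u₂ v₀ v₁ v₂ w₀ w₁ w₂ :* a₀ :=
        :minor v₁ v₂ w₁ w₂ :* :dot₃ a₀ a₁ a₂ u₀ u₁ u₂ :+ :minor w₁ w₂ u₁ u₂ :* :dot₃ a₀ a₁ a₂ v₀ v₁ v₂
        :+ :minor u₁ u₂ v₁ v₂ :* :dot₃ a₀ a₁ a₂ w₀ w₁ w₂) refl u₀ u₁ u₂ v₀ v₁ v₂ w₀ w₁ w₂ a₀ a₁ a₂

    cramer₁ : d * a₁ ≡ minor v₂ v₀ w₂ w₀ * a·u + minor w₂ w₀ u₂ u₀ * a·v + minor u₂ u₀ v₂ v₀ * a·w
    cramer₁ = solve 12 (λ u₀ u₁ u₂ v₀ v₁ v₂ w₀ w₁ w₂ a₀ a₁ a₂ →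
      :det₃ u₀ u₁ u₂ v₀ v₁ v₂ w₀ w₁ w₂ :* a₁ :=
        :minor v₂ v₀ w₂ w₀ :* :dot₃ a₀ a₁ a₂ u₀ u₁ u₂ :+ :minor w₂ w₀ u₂ u₀ :* :dot₃ a₀ a₁ a₂ v₀ v₁ v₂
        :+ :minor u₂ u₀ v₂ v₀ :* :dot₃ a₀ a₁ a₂ w₀ w₁ w₂) refl u₀ u₁ u₂ v₀ v₁ v₂ w₀ w₁ w₂ a₀ a₁ a₂

    cramer₂ : d * a₂ ≡ minor v₀ v₁ w₀ w₁ * a·u + minor w₀ w₁ u₀ u₁ * a·v + minor u₀ u₁ v₀ v₁ * a·w
    cramer₂ = solve 12 (λ u₀ u₁ u₂ v₀ v₁ v₂ w₀ w₁ w₂ a₀ a₁ a₂ →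
      :det₃ u₀ u₁ u₂ v₀ v₁ v₂ w₀ w₁ w₂ :* a₂ :=
        :minor v₀ v₁ w₀ w₁ :* :dot₃ a₀ a₁ a₂ u₀ u₁ u₂ :+ :minor w₀ w₁ u₀ u₁ :* :dot₃ a₀ a₁ a₂ v₀ v₁ v₂
        :+ :minor u₀ u₁ v₀ v₁ :* :dot₃ a₀ a₁ a₂ w₀ w₁ w₂) refl u₀ u₁ u₂ v₀ v₁ v₂ w₀ w₁ w₂ a₀ a₁ a₂

  det-same-point : ∀ u v w → SamePoint u v → det u v w ≡ 0#
  det-same-point ⟨ u₀ , u₁ , u₂ ⟩ ⟨ _ , _ , _ ⟩ ⟨ w₀ , w₁ , w₂ ⟩ (λ′ , _ , refl , refl , refl) =
    solve 7 (λ u₀ u₁ u₂ λ′ w₀ w₁ w₂ → :det₃ u₀ u₁ u₂ (λ′ :* u₀) (λ′ :* u₁) (λ′ :* u₂) w₀ w₁ w₂ := :0)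
      refl u₀ u₁ u₂ λ′ w₀ w₁ w₂

  det-zero-row : ∀ u v w → (c0 u ≡ 0# × c1 u ≡ 0# × c2 u ≡ 0#) → det u v w ≡ 0#
  det-zero-row ⟨ _ , _ , _ ⟩ ⟨ v₀ , v₁ , v₂ ⟩ ⟨ w₀ , w₁ , w₂ ⟩ (refl , refl , refl) =
    solve 6 (λ v₀ v₁ v₂ w₀ w₁ w₂ → :det₃ :0 :0 :0 v₀ v₁ v₂ w₀ w₁ w₂ := :0) refl v₀ v₁ v₂ w₀ w₁ w₂

  det-swap₁₂ : ∀ u v w → det u v w ≢ 0# → det v u w ≢ 0#
  det-swap₁₂ ⟨ u₀ , u₁ , u₂ ⟩ ⟨ v₀ , v₁ , v₂ ⟩ ⟨ w₀ , w₁ , w₂ ⟩ det≢0 det′≡0 = -‿nonzero det≢0 (trans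
    (solve 9 (λ u₀ u₁ u₂ v₀ v₁ v₂ w₀ w₁ w₂ →
       :- :det₃ u₀ u₁ u₂ v₀ v₁ v₂ w₀ w₁ w₂ := :det₃ v₀ v₁ v₂ u₀ u₁ u₂ w₀ w₁ w₂) refl u₀ u₁ u₂ v₀ v₁ v₂ w₀ w₁ w₂)
    det′≡0)

  det-swap₂₃ : ∀ u v w → det u v w ≢ 0# → det u w v ≢ 0#
  det-swap₂₃ ⟨ u₀ , u₁ , u₂ ⟩ ⟨ v₀ , v₁ , v₂ ⟩ ⟨ w₀ , w₁ , w₂ ⟩ det≢0 det′≡0 = -‿nonzero det≢0 (trans
    (solve 9 (λ u₀ u₁ u₂ v₀ v₁ v₂ w₀ w₁ w₂ →
       :- :det₃ u₀ u₁ u₂ v₀ v₁ v₂ w₀ w₁ w₂ := :det₃ u₀ u₁ u₂ w₀ w₁ w₂ v₀ v₁ v₂) refl u₀ u₁ u₂ v₀ v₁ v₂ w₀ w₁ w₂)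
    det′≡0)

  -- A list of at least three triples in which any three distinct entries have
  -- nonzero determinant is an arc: a third entry witnesses that every entry is a
  -- point and that distinct entries are distinct points.
  arc-criterion : ∀ pts → 3 ℕ.≤ length pts →
    (∀ i j l → i ≢ j → j ≢ l → i ≢ l → det (lookup pts i) (lookup pts j) (lookup pts l) ≢ 0#) →
    IsArc (length pts) pts
  arc-criterion pts 3≤n det≢0 = refl , nonzero , distinct , noncollinear
    where
    nonzero : ∀ i → NonZeroTriple (lookup pts i)
    nonzero i zero-row with avoid 3≤n i i
    ... | j , i≢j , _ with avoid 3≤n i j
    ...   | l , i≢l , j≢l = det≢0 i j l i≢j j≢l i≢l (det-zero-row _ _ _ zero-row)
    distinct : ∀ i j → i ≢ j → ¬ SamePoint (lookup pts i) (lookup pts j)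
    distinct i j i≢j same with avoid 3≤n i j
    ... | l , i≢l , j≢l = det≢0 i j l i≢j j≢l i≢l (det-same-point _ _ _ same)
    noncollinear : ∀ i j l → i ≢ j → j ≢ l → i ≢ l → ¬ Collinear (lookup pts i) (lookup pts j) (lookup pts l)
    noncollinear i j l i≢j j≢l i≢l = det-nonzero⇒¬collinear _ _ _ (det≢0 i j l i≢j j≢l i≢l)

sort3 : ∀ {A : Set} {_≺_ : A → A → Set} (R : A → A → A → Set) →
        (∀ {x y} → x ≢ y → x ≺ y ⊎ y ≺ x) →
        (∀ {x y z} → R x y z → R y x z) → (∀ {x y z} → R x y z → R x z y) →
        (∀ {x y z} → x ≺ y → y ≺ z → R x y z) →
        ∀ {x y z} → x ≢ y → y ≢ z → x ≢ z → R x y z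
sort3 R compare swap₁₂ swap₂₃ increasing x≢y y≢z x≢z with compare x≢y | compare y≢z
... | inj₁ x≺y | inj₁ y≺z = increasing x≺y y≺z
... | inj₂ y≺x | inj₂ z≺y = swap₁₂ (swap₂₃ (swap₁₂ (increasing z≺y y≺x)))
... | inj₁ x≺y | inj₂ z≺y with compare x≢z
...   | inj₁ x≺z = swap₂₃ (increasing x≺z z≺y)
...   | inj₂ z≺x = swap₂₃ (swap₁₂ (increasing z≺x x≺y))
sort3 R compare swap₁₂ swap₂₃ increasing x≢y y≢z x≢z | inj₂ y≺x | inj₁ y≺z with compare x≢z
...   | inj₁ x≺z = swap₁₂ (increasing y≺x x≺z)
...   | inj₂ z≺x = swap₁₂ (swap₂₃ (increasing y≺z z≺x))

lookup-map-++ : ∀ {A B : Set} (g : A → B) (xs : List A) (ys : List B) (i : Fin (length (map g xs ++ ys))) →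
  (∃ λ (k : Fin (length xs)) → toℕ i ≡ toℕ k × lookup (map g xs ++ ys) i ≡ g (lookup xs k)) ⊎
  (∃ λ (k : Fin (length ys)) → toℕ i ≡ length xs ℕ.+ toℕ k × lookup (map g xs ++ ys) i ≡ lookup ys k)
lookup-map-++ g []       ys i           = inj₂ (i , refl , refl)
lookup-map-++ g (x ∷ xs) ys Fin.zero    = inj₁ (Fin.zero , refl , refl)
lookup-map-++ g (x ∷ xs) ys (Fin.suc i) with lookup-map-++ g xs ys i
... | inj₁ (k , i≡k , entry) = inj₁ (Fin.suc k , cong suc i≡k , entry)
... | inj₂ (k , i≡n+k , entry) = inj₂ (k , cong suc i≡n+k , entry)

distinct-sum≢0 : ∀ {a b} → a ≢ b → a ℕ.+ b ≢ 0
distinct-sum≢0 {a} a≢b a+b≡0 = a≢b (trans (ℕP.m+n≡0⇒m≡0 a a+b≡0) (sym (ℕP.m+n≡0⇒n≡0 a a+b≡0)))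

distinct-sum≢double : ∀ {a b J} → a ℕ.≤ J → b ℕ.≤ J → a ≢ b → a ℕ.+ b ≢ J ℕ.+ J
distinct-sum≢double {a} {b} a≤J b≤J a≢b with ℕP.<-cmp a b
... | tri< a<b _ _ = ℕP.<⇒≢ (ℕP.+-mono-<-≤ (ℕP.<-≤-trans a<b b≤J) b≤J)
... | tri≈ _ a≡b _ = ⊥-elim (a≢b a≡b)
... | tri> _ _ b<a = ℕP.<⇒≢ (ℕP.+-mono-≤-< a≤J (ℕP.<-≤-trans b<a a≤J))

module Configuration {q : ℕ} (F : FiniteField q) (ξ : FiniteField.Carrier F)
  (ξ-primitive : FiniteField.IsPrimitive F ξ) (m : ℕ) (q≡4m+3 : q ≡ 3 ℕ.+ m ℕ.* 4)
  (J : ℕ) (1≤J : 1 ℕ.≤ J) (J≤2m : J ℕ.≤ m ℕ.* 2) where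
  open FieldFacts F
  open ProjectivePlane F
  open PrimitiveElement F ξ ξ-primitive (2 ℕ.+ m ℕ.* 4) q≡4m+3

  -- the order N = q - 1 of ξ is 2h with h = 2m + 1 odd
  h : ℕ
  h = 1 ℕ.+ m ℕ.* 2

  N≡h+h : 2 ℕ.+ m ℕ.* 4 ≡ h ℕ.+ h
  N≡h+h = arithmetic m
    where arithmetic : ∀ m → 2 ℕ.+ m ℕ.* 4 ≡ (1 ℕ.+ m ℕ.* 2) ℕ.+ (1 ℕ.+ m ℕ.* 2)
          arithmetic = solve-∀

  h-odd : h % 2 ≡ 1
  h-odd = [m+kn]%n≡m%n 1 m 2

  -- points (1, t, t²) of the conic x₁² = x₀x₂ and points (1, 0, -y²) of the line x₁ = 0
  conic axial : Carrier → Triple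
  conic t = ⟨ 1# , t , t * t ⟩
  axial y = ⟨ 1# , 0# , - (y * y) ⟩

  det-conic-conic-conic : ∀ s t r → det (conic s) (conic t) (conic r) ≡ (t - s) * (r - s) * (r - t)
  det-conic-conic-conic = solve 3 (λ s t r →
    :det₃ :1 s (s :* s) :1 t (t :* t) :1 r (r :* r) := (t :- s) :* (r :- s) :* (r :- t)) refl

  det-conic-conic-P : ∀ s t → det (conic s) (conic t) P ≡ (s - t) * (s + t)
  det-conic-conic-P = solve 2 (λ s t →
    :det₃ :1 s (s :* s) :1 t (t :* t) :0 :1 :0 := (s :- t) :* (s :+ t)) refl

  det-conic-conic-axial : ∀ s t y → det (conic s) (conic t) (axial y) ≡ (s - t) * (y * y - s * t)
  det-conic-conic-axial = solve 3 (λ s t y →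
    :det₃ :1 s (s :* s) :1 t (t :* t) :1 :0 (:- (y :* y)) := (s :- t) :* (y :* y :- s :* t)) refl

  det-conic-P-axial : ∀ t y → det (conic t) P (axial y) ≡ - (t * t + y * y)
  det-conic-P-axial = solve 2 (λ t y →
    :det₃ :1 t (t :* t) :0 :1 :0 :1 :0 (:- (y :* y)) := :- (t :* t :+ y :* y)) refl

  det-conic-axial-axial : ∀ t y z → det (conic t) (axial y) (axial z) ≡ t * (z * z - y * y)
  det-conic-axial-axial = solve 3 (λ t y z →
    :det₃ :1 t (t :* t) :1 :0 (:- (y :* y)) :1 :0 (:- (z :* z)) := t :* (z :* z :- y :* y)) refl

  det-P-axial-axial : ∀ y z → det P (axial y) (axial z) ≡ z * z - y * y
  det-P-axial-axial = solve 2 (λ y z →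
    :det₃ :0 :1 :0 :1 :0 (:- (y :* y)) :1 :0 (:- (z :* z)) := z :* z :- y :* y) refl

  -- exponent sums a + b with a, b ≤ J stay below the order of ξ, so they are
  -- determined by the corresponding products of powers
  sum<order : ∀ {a b} → a ℕ.≤ J → b ℕ.≤ J → a ℕ.+ b ℕ.< 2 ℕ.+ m ℕ.* 4
  sum<order {a} {b} a≤J b≤J = s≤s (begin
    a ℕ.+ b              ≤⟨ ℕP.+-mono-≤ (ℕP.≤-trans a≤J J≤2m) (ℕP.≤-trans b≤J J≤2m) ⟩
    m ℕ.* 2 ℕ.+ m ℕ.* 2  ≡⟨ arithmetic m ⟩
    m ℕ.* 4              ≤⟨ ℕP.n≤1+n _ ⟩
    suc (m ℕ.* 4)        ∎)
    where
    open ℕP.≤-Reasoning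
    arithmetic : ∀ m → m ℕ.* 2 ℕ.+ m ℕ.* 2 ≡ m ℕ.* 4
    arithmetic = solve-∀

  exponent<order : ∀ {a} → a ℕ.≤ J → a ℕ.< 2 ℕ.+ m ℕ.* 4
  exponent<order {a} a≤J = ℕP.≤-<-trans (ℕP.m≤m+n a 0) (sum<order a≤J z≤n)

  product-exponents : ∀ {a b c d} → a ℕ.≤ J → b ℕ.≤ J → c ℕ.≤ J → d ℕ.≤ J →
                      ξ ^ a * ξ ^ b ≡ ξ ^ c * ξ ^ d → a ℕ.+ b ≡ c ℕ.+ d
  product-exponents {a} {b} {c} {d} a≤J b≤J c≤J d≤J eq = ^-injective (sum<order a≤J b≤J) (sum<order c≤J d≤J)
    (trans (^-+ ξ a b) (trans eq (sym (^-+ ξ c d))))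

  power-difference : ∀ {a b} → a ℕ.≤ J → b ℕ.≤ J → a ≢ b → ξ ^ a - ξ ^ b ≢ 0#
  power-difference {a} {b} a≤J b≤J a≢b = difference-nonzero (λ ξᵃ≡ξᵇ →
    a≢b (^-injective (exponent<order a≤J) (exponent<order b≤J) ξᵃ≡ξᵇ))

  -- ξ^a + ξ^b = 0 would give ξ^2a = ξ^2b, hence a = b
  power-sum : ∀ {a b} → a ℕ.≤ J → b ℕ.≤ J → a ≢ b → ξ ^ a + ξ ^ b ≢ 0#
  power-sum {a} {b} a≤J b≤J a≢b sum≡0 = a≢b (ℕP.*-cancelʳ-≡ a b 2 (begin
    a ℕ.* 2   ≡⟨ double a ⟩
    a ℕ.+ a   ≡⟨ product-exponents a≤J a≤J b≤J b≤J squares ⟩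
    b ℕ.+ b   ≡⟨ sym (double b) ⟩
    b ℕ.* 2   ∎))
    where
    open ≡-Reasoning
    double : ∀ n → n ℕ.* 2 ≡ n ℕ.+ n
    double = solve-∀
    squares : ξ ^ a * ξ ^ a ≡ ξ ^ b * ξ ^ b
    squares = trans (cong (λ x → x * x) (+-inverseˡ-unique _ _ sum≡0))
                    (solve 1 (λ y → :- y :* :- y := y :* y) refl (ξ ^ b))

  square-minus-product : ∀ {a b e} → a ℕ.≤ J → b ℕ.≤ J → e ℕ.≤ J → a ℕ.+ b ≢ e ℕ.+ e →
                         ξ ^ e * ξ ^ e - ξ ^ a * ξ ^ b ≢ 0#
  square-minus-product a≤J b≤J e≤J a+b≢e+e = difference-nonzero (λ eq →
    a+b≢e+e (sym (product-exponents e≤J e≤J a≤J b≤J eq)))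

  -- t² + y² ≠ 0 since -1 is not a square in F_q
  sum-of-squares : ∀ a e → ξ ^ a * ξ ^ a + ξ ^ e * ξ ^ e ≢ 0#
  sum-of-squares a e = sum-of-squares-nonzero h N≡h+h h-odd (ξ ^ a) (ξ ^ e) (^-nonzero e ξ≢0)

  -- ξ^J · ξ^J ≠ 1 because 1 ≤ J
  J²≢1 : ξ ^ J * ξ ^ J - ξ ^ 0 * ξ ^ 0 ≢ 0#
  J²≢1 = square-minus-product z≤n z≤n ℕP.≤-refl (λ 0≡J+J → ℕP.<⇒≢ (ℕP.<-≤-trans 1≤J (ℕP.m≤m+n J J)) 0≡J+J)

  data Entry : Set where
    onConic : ℕ → Entry
    pointP pointZ pointB : Entry

  admissible : Entry → Set
  admissible (onConic d) = d ℕ.≤ J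
  admissible _           = ⊤

  -- Z = (1, 0, -1) and B_J = (1, 0, -ξ^2J) are axial points with y = 1 and y = ξ^J
  point : Entry → Triple
  point (onConic d) = conic (ξ ^ d)
  point pointP      = P
  point pointZ      = axial (ξ ^ 0)
  point pointB      = axial (ξ ^ J)

  data _≺_ : Entry → Entry → Set where
    conic≺conic : ∀ {a b} → a ℕ.< b → onConic a ≺ onConic b
    conic≺P     : ∀ {a} → onConic a ≺ pointP
    conic≺Z     : ∀ {a} → onConic a ≺ pointZ
    conic≺B     : ∀ {a} → onConic a ≺ pointB
    P≺Z         : pointP ≺ pointZ
    P≺B         : pointP ≺ pointB
    Z≺B         : pointZ ≺ pointB

  ≺-compare : ∀ {x y} → x ≢ y → x ≺ y ⊎ y ≺ x
  ≺-compare {onConic a} {onConic b} x≢y with ℕP.<-cmp a b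
  ... | tri< a<b _ _ = inj₁ (conic≺conic a<b)
  ... | tri≈ _ a≡b _ = ⊥-elim (x≢y (cong onConic a≡b))
  ... | tri> _ _ b<a = inj₂ (conic≺conic b<a)
  ≺-compare {onConic _} {pointP}    _ = inj₁ conic≺P
  ≺-compare {onConic _} {pointZ}    _ = inj₁ conic≺Z
  ≺-compare {onConic _} {pointB}    _ = inj₁ conic≺B
  ≺-compare {pointP}    {onConic _} _ = inj₂ conic≺P
  ≺-compare {pointZ}    {onConic _} _ = inj₂ conic≺Z
  ≺-compare {pointB}    {onConic _} _ = inj₂ conic≺B
  ≺-compare {pointP}    {pointZ}    _ = inj₁ P≺Z
  ≺-compare {pointP}    {pointB}    _ = inj₁ P≺B
  ≺-compare {pointZ}    {pointB}    _ = inj₁ Z≺B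
  ≺-compare {pointZ}    {pointP}    _ = inj₂ P≺Z
  ≺-compare {pointB}    {pointP}    _ = inj₂ P≺B
  ≺-compare {pointB}    {pointZ}    _ = inj₂ Z≺B
  ≺-compare {pointP}    {pointP}  x≢y = ⊥-elim (x≢y refl)
  ≺-compare {pointZ}    {pointZ}  x≢y = ⊥-elim (x≢y refl)
  ≺-compare {pointB}    {pointB}  x≢y = ⊥-elim (x≢y refl)

  NonCollinearEntries : Entry → Entry → Entry → Set
  NonCollinearEntries x y z = admissible x → admissible y → admissible z → det (point x) (point y) (point z) ≢ 0#

  increasing-noncollinear : ∀ {x y z} → x ≺ y → y ≺ z → NonCollinearEntries x y z
  increasing-noncollinear (conic≺conic a<b) (conic≺conic b<d) a≤J b≤J d≤J = det-conic-conic-conic _ _ _ ▹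
    *-nonzero (*-nonzero (power-difference b≤J a≤J (ℕP.>⇒≢ a<b)) (power-difference d≤J a≤J (ℕP.>⇒≢ (ℕP.<-trans a<b b<d))))
              (power-difference d≤J b≤J (ℕP.>⇒≢ b<d))
  increasing-noncollinear (conic≺conic a<b) conic≺P a≤J b≤J _ = det-conic-conic-P _ _ ▹
    *-nonzero (power-difference a≤J b≤J (ℕP.<⇒≢ a<b)) (power-sum a≤J b≤J (ℕP.<⇒≢ a<b))
  increasing-noncollinear (conic≺conic a<b) conic≺Z a≤J b≤J _ = det-conic-conic-axial _ _ _ ▹
    *-nonzero (power-difference a≤J b≤J (ℕP.<⇒≢ a<b)) (square-minus-product a≤J b≤J z≤n (distinct-sum≢0 (ℕP.<⇒≢ a<b)))
  increasing-noncollinear (conic≺conic a<b) conic≺B a≤J b≤J _ = det-conic-conic-axial _ _ _ ▹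
    *-nonzero (power-difference a≤J b≤J (ℕP.<⇒≢ a<b))
              (square-minus-product a≤J b≤J ℕP.≤-refl (distinct-sum≢double a≤J b≤J (ℕP.<⇒≢ a<b)))
  increasing-noncollinear {onConic a} conic≺P P≺Z _ _ _ = det-conic-P-axial _ _ ▹ -‿nonzero (sum-of-squares a 0)
  increasing-noncollinear {onConic a} conic≺P P≺B _ _ _ = det-conic-P-axial _ _ ▹ -‿nonzero (sum-of-squares a J)
  increasing-noncollinear {onConic a} conic≺Z Z≺B _ _ _ = det-conic-axial-axial _ _ _ ▹
    *-nonzero (^-nonzero a ξ≢0) J²≢1
  increasing-noncollinear P≺Z Z≺B _ _ _ = det-P-axial-axial _ _ ▹ J²≢1

  distinct-noncollinear : ∀ {x y z} → x ≢ y → y ≢ z → x ≢ z → NonCollinearEntries x y z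
  distinct-noncollinear = sort3 NonCollinearEntries ≺-compare swap₁₂ swap₂₃ increasing-noncollinear
    where
    swap₁₂ : ∀ {x y z} → NonCollinearEntries x y z → NonCollinearEntries y x z
    swap₁₂ nc y-ok x-ok z-ok = det-swap₁₂ _ _ _ (nc x-ok y-ok z-ok)
    swap₂₃ : ∀ {x y z} → NonCollinearEntries x y z → NonCollinearEntries x z y
    swap₂₃ nc x-ok z-ok y-ok = det-swap₂₃ _ _ _ (nc x-ok y-ok z-ok)

  position : Entry → ℕ
  position (onConic d) = d
  position pointP      = suc J ℕ.+ 0
  position pointZ      = suc J ℕ.+ 1
  position pointB      = suc J ℕ.+ 2

  square-power : ∀ e → ξ ^ (2 ℕ.* e) ≡ ξ ^ e * ξ ^ e
  square-power e = trans (cong (λ n → ξ ^ (e ℕ.+ n)) (ℕP.+-identityʳ e)) (^-+ ξ e e)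

  conic-entry : ℕ → Triple
  conic-entry d = ⟨ 1# , ξ ^ d , ξ ^ (2 ℕ.* d) ⟩

  conic-entry≡ : ∀ d → conic-entry d ≡ conic (ξ ^ d)
  conic-entry≡ d = cong (λ y → ⟨ 1# , ξ ^ d , y ⟩) (square-power d)

  axial-entry≡ : ∀ e → B ξ e ≡ axial (ξ ^ e)
  axial-entry≡ e = cong (λ y → ⟨ 1# , 0# , - y ⟩) (square-power e)

  after-conic : ∀ {n} k → n ≡ length (upTo (suc J)) ℕ.+ k → n ≡ suc J ℕ.+ k
  after-conic k n≡ = trans n≡ (cong (ℕ._+ k) (LP.length-upTo (suc J)))

  classify : ∀ i → ∃ λ x → admissible x × toℕ i ≡ position x × lookup (E ξ J) i ≡ point x
  classify i with lookup-map-++ conic-entry (upTo (suc J)) (P ∷ Z ∷ B ξ J ∷ []) i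
  ... | inj₁ (k , i≡k , entry) =
    onConic (toℕ k) , k≤J , i≡k , trans entry (trans (cong conic-entry (LP.lookup-upTo (suc J) k)) (conic-entry≡ (toℕ k)))
    where
    k≤J : toℕ k ℕ.≤ J
    k≤J = ℕP.≤-pred (subst (toℕ k ℕ.<_) (LP.length-upTo (suc J)) (FinP.toℕ<n k))
  ... | inj₂ (Fin.zero , i≡n+0 , entry) = pointP , tt , after-conic 0 i≡n+0 , entry
  ... | inj₂ (Fin.suc Fin.zero , i≡n+1 , entry) = pointZ , tt , after-conic 1 i≡n+1 , trans entry (axial-entry≡ 0)
  ... | inj₂ (Fin.suc (Fin.suc Fin.zero) , i≡n+2 , entry) = pointB , tt , after-conic 2 i≡n+2 , trans entry (axial-entry≡ J)

  det-E : ∀ i j l → i ≢ j → j ≢ l → i ≢ l → det (lookup (E ξ J) i) (lookup (E ξ J) j) (lookup (E ξ J) l) ≢ 0#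
  det-E i j l i≢j j≢l i≢l with classify i | classify j | classify l
  ... | x , x-ok , i≡x , Eᵢ≡x | y , y-ok , j≡y , Eⱼ≡y | z , z-ok , l≡z , Eₗ≡z =
    trans (cong₂ (λ u v → det u v _) Eᵢ≡x Eⱼ≡y) (cong (det _ _) Eₗ≡z) ▹
      distinct-noncollinear (separate i≡x j≡y i≢j) (separate j≡y l≡z j≢l) (separate i≡x l≡z i≢l) x-ok y-ok z-ok
    where
    separate : ∀ {i j : Fin (length (E ξ J))} {x y} → toℕ i ≡ position x → toℕ j ≡ position y → i ≢ j → x ≢ y
    separate i≡x j≡y i≢j x≡y = i≢j (FinP.toℕ-injective (trans i≡x (trans (cong position x≡y) (sym j≡y))))

  length-E : length (E ξ J) ≡ J ℕ.+ 4
  length-E = begin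
    length (E ξ J)                                   ≡⟨ LP.length-++ (map conic-entry (upTo (suc J))) ⟩
    length (map conic-entry (upTo (suc J))) ℕ.+ 3    ≡⟨ cong (ℕ._+ 3) (LP.length-map conic-entry (upTo (suc J))) ⟩
    length (upTo (suc J)) ℕ.+ 3                      ≡⟨ cong (ℕ._+ 3) (LP.length-upTo (suc J)) ⟩
    suc J ℕ.+ 3                                      ≡⟨ sym (ℕP.+-suc J 3) ⟩
    J ℕ.+ 4                                          ∎
    where open ≡-Reasoning

  E-arc : IsArc (J ℕ.+ 4) (E ξ J)
  E-arc = subst (λ n → IsArc n (E ξ J)) length-E (arc-criterion (E ξ J) three-entries det-E)
    where
    three-entries : 3 ℕ.≤ length (E ξ J)
    three-entries = subst (3 ℕ.≤_) (sym length-E) (ℕP.≤-trans (ℕP.n≤1+n 3) (ℕP.m≤n+m 4 J))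

q-decomposition : ∀ q → q % 4 ≡ 3 → q ≡ 3 ℕ.+ (q / 4) ℕ.* 4
q-decomposition q q%4≡3 = trans (m≡m%n+[m/n]*n q 4) (cong (ℕ._+ (q / 4) ℕ.* 4) q%4≡3)

quarter : ∀ m → (3 ℕ.+ m ℕ.* 4 ∸ 3) / 4 ≡ m
quarter m = trans (cong (_/ 4) (ℕP.m+n∸m≡n 3 (m ℕ.* 4))) (m*n/n≡m m 4)

half : ∀ m → (3 ℕ.+ m ℕ.* 4 ∸ 3) / 2 ≡ m ℕ.* 2
half m = trans (cong (_/ 2) (trans (ℕP.m+n∸m≡n 3 (m ℕ.* 4)) (arithmetic m))) (m*n/n≡m (m ℕ.* 2) 2)
  where arithmetic : ∀ m → m ℕ.* 4 ≡ m ℕ.* 2 ℕ.* 2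
        arithmetic = solve-∀

-- the bound q ≥ 27 gives m ≥ 1, hence J ≥ 1
quarter-positive : ∀ m → 27 ℕ.≤ 3 ℕ.+ m ℕ.* 4 → 1 ℕ.≤ m
quarter-positive zero    (s≤s (s≤s (s≤s ())))
quarter-positive (suc m) _ = s≤s z≤n

open import Data.Nat using (_+_; _≤_)

-- The hypotheses give q = 4m + 3 and 1 ≤ J ≤ 2m.

theorem19 : (q : ℕ) → IsPrimePower q → 27 ≤ q → q % 4 ≡ 3 →
    (F : FiniteField q) → (ξ : FiniteField.Carrier F) → FiniteField.IsPrimitive F ξ →
    (J : ℕ) → (q ∸ 3) / 4 ≤ J → J ≤ (q ∸ 3) / 2 →
    FiniteField.IsArc F (J + 4) (FiniteField.E F ξ J)
theorem19 q _ 27≤q q%4≡3 F ξ ξ-primitive J lower upper =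
  Configuration.E-arc F ξ ξ-primitive m q≡4m+3 J 1≤J J≤2m
  where
  m : ℕ
  m = q / 4
  q≡4m+3 : q ≡ 3 + m ℕ.* 4
  q≡4m+3 = q-decomposition q q%4≡3
  J≤2m : J ≤ m ℕ.* 2
  J≤2m = subst (J ≤_) (trans (cong (λ n → (n ∸ 3) / 2) q≡4m+3) (half m)) upper
  m≤J : m ≤ J
  m≤J = subst (_≤ J) (trans (cong (λ n → (n ∸ 3) / 4) q≡4m+3) (quarter m)) lower
  1≤J : 1 ≤ J
  1≤J = ℕP.≤-trans (quarter-positive m (subst (27 ≤_) q≡4m+3 27≤q)) m≤J
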